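{- Let $S$ be a tree, $k\ge 2$, and let $A\subseteq V(S)$ be a $k$-admissible set. (i) If $|\delta(A)|<k$, then every node $r\in A$ is a $k$-admissible root of $A$. (ii) If $|\delta(A)|=k$, then the set of $k$-admissible roots of $A$ is $V(\mathrm{ch}(\delta(A)))\cap A$.
   Context: For $B\subseteq V(S)$, $\delta(B)$ is the set of nodes outside $B$ adjacent in $S$ to some node of $B$. A set $A\subseteq V(S)$ is $k$-admissible if $S[A]$ is connected and $|\delta(A)|\le k$. A node $x\in A$ is a $k$-admissible root of $A$ if the node sets of all connected components of $S[A]\setminus x$ are $k$-admissible. The convex hull $\mathrm{ch}(B)$ is the subtree of $S$ induced by the union of all paths in $S$ between nodes of $B$. -}

module Defs where

open import Data.Nat using (ℕ; zero; suc; _≤_; _<_)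
open import Data.Bool using (Bool; true; false; T; _∧_; _∨_; not)
open import Data.Fin using (Fin)
open import Data.Fin.Subset using (Subset; _∈_; _∉_; _⊆_; _-_; ∣_∣; Nonempty; ⊤)
open import Data.Vec using (Vec; tabulate; lookup)
open import Data.List using (List; []; _∷_; length)
import Data.List.Membership.Propositional as LM
open import Data.List.Relation.Unary.All using (All)
open import Data.List.Relation.Unary.Unique.Propositional using (Unique)
open import Data.Product using (Σ; ∃; ∃-syntax; _×_)
open import Relation.Binary.PropositionalEquality using (_≡_)
open import Relation.Nullary using (¬_)

record Graph (n : ℕ) : Set where
  field
    adj    : Fin n → Fin n → Bool
    symm   : ∀ u v → adj u v ≡ adj v u
    irrefl : ∀ v → adj v v ≡ false

open Graph public

Adj : ∀ {n} → Graph n → Fin n → Fin n → Set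
Adj G u v = T (adj G u v)

data Walk {n} (G : Graph n) : Fin n → Fin n → List (Fin n) → Set where
  single : ∀ v → Walk G v v (v ∷ [])
  step   : ∀ {u v w vs} → Adj G u v → Walk G v w vs → Walk G u w (u ∷ vs)

Path : ∀ {n} → Graph n → Fin n → Fin n → List (Fin n) → Set
Path G u w vs = Walk G u w vs × Unique vs

Connected : ∀ {n} → Graph n → Subset n → Set
Connected G B =
  ∀ u v → u ∈ B → v ∈ B → ∃[ vs ] (Walk G u v vs × All (_∈ B) vs)

Cycle : ∀ {n} → Graph n → Set
Cycle G = ∃[ u ] ∃[ w ] ∃[ vs ]
  (Path G u w vs × 3 ≤ length vs × Adj G w u)

Acyclic : ∀ {n} → Graph n → Set
Acyclic G = ¬ Cycle G

IsTree : ∀ {n} → Graph n → Set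
IsTree G = Connected G ⊤ × Acyclic G

anyFin : ∀ {n} → (Fin n → Bool) → Bool
anyFin {zero}  f = false
anyFin {suc n} f = f Fin.zero ∨ anyFin (λ i → f (Fin.suc i))

inB : ∀ {n} → Subset n → Fin n → Bool
inB B v with lookup B v
... | true  = true
... | false = false

δ : ∀ {n} → Graph n → Subset n → Subset n
δ G B = tabulate (λ v → not (inB B v) ∧ anyFin (λ u → inB B u ∧ adj G u v))

Admissible : ∀ {n} → Graph n → ℕ → Subset n → Set
Admissible G k A = Connected G A × ∣ δ G A ∣ ≤ k

IsComponent : ∀ {n} → Graph n → Subset n → Subset n → Set
IsComponent G B C =
  Nonempty C × C ⊆ B × Connected G C ×
  (∀ u w → u ∈ C → w ∈ B → Adj G u w → w ∈ C)

IsAdmissibleRoot : ∀ {n} → Graph n → ℕ → Subset n → Fin n → Set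
IsAdmissibleRoot G k A x =
  x ∈ A × (∀ C → IsComponent G (A - x) C → Admissible G k C)

-- v is a node of the convex hull ch(B): v lies on some path of G
-- between two (not necessarily distinct) nodes of B.
InHull : ∀ {n} → Graph n → Subset n → Fin n → Set
InHull G B v = ∃[ u ] ∃[ w ] ∃[ vs ]
  (u ∈ B × w ∈ B × Path G u w vs × v LM.∈ vs)

-- Every component C of A − r satisfies δ(C) ⊆ δ(A) ∪ {r}, which gives (i).
-- If r ∈ A lies on a path between u, w ∈ δ(A), no component of A − r can be
-- adjacent to both u and w, since that would give a walk between the two path
-- neighbours of r avoiding r, i.e. a cycle; dropping u (or w) from the bound
-- above yields |δ(C)| ≤ |δ(A)|.  Conversely, let r be an admissible root when
-- |δ(A)| = k.  Follow a path inside A from r out to some d₁ ∈ δ(A).  If it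
-- leaves r into a component C of A − r, then r ∈ δ(C) ∖ δ(A) and |δ(C)| ≤ k
-- force some d₂ ∈ δ(A) ∖ δ(C); a path from r out to d₂ cannot enter C, so the
-- two paths glue into a path from d₁ to d₂ through r.  If r is adjacent to d₁
-- itself, the same applies to a second element d₂ of δ(A), unless r is adjacent
-- to d₂ as well, in which case d₁ r d₂ is the path.

module Submission where

open import Defs
open import Data.Bool using (Bool; true; false; T; not; _∧_; _∨_)
open import Data.Bool.Properties using (T-≡; T-∧; T-∨)
open import Data.Empty using (⊥-elim)
open import Data.Fin using (Fin; zero; suc; _≟_)
open import Data.Fin.Properties using (any?)
open import Data.Fin.Subset using (Subset; _∈_; _∉_; _⊆_; _⊂_; _─_; _-_; _∪_; ⁅_⁆; ⊥; ∣_∣)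
open import Data.Fin.Subset.Properties
  using (_∈?_; p⊆q⇒∣p∣≤∣q∣; p⊂q⇒∣p∣<∣q∣; p─q⊆p; x∈p∧x≢y⇒x∈p-y; x∉⁅y⁆⇒x≢y;
         x∈⁅x⁆; x∈⁅y⁆⇒x≡y; ∉⊥; ∣p∣≤n; ∣⊥∣≡0; ∣⁅x⁆∣≡1; x∈p∪q⁻; x∈p∪q⁺; x∈p⇒∣p-x∣<∣p∣)
open import Data.Nat using (ℕ; zero; suc; _+_; _≤_; _<_; z≤n; s≤s)
open import Data.Nat.Properties using (≤-trans; <-≤-trans; <⇒≱; +-suc; +-comm; m≤n⇒m≤1+n; ≤-reflexive; module ≤-Reasoning)
open import Data.Product using (∃; ∃₂; _×_; _,_; proj₁; proj₂)
open import Data.Sum using (_⊎_; inj₁; inj₂)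
open import Data.Vec using (tabulate; lookup; []; _∷_)
import Data.Vec.Base as Vec
open import Data.Vec.Properties using (lookup∘tabulate; []=⇒lookup; lookup⇒[]=)
open import Data.List using (List; []; _∷_; _++_; [_]; reverse; drop; length)
open import Data.List.Properties using (unfold-reverse)
open import Data.List.Membership.Propositional using (lose) renaming (_∈_ to _∈ₗ_; _∉_ to _∉ₗ_)
open import Data.List.Relation.Binary.Subset.Propositional using () renaming (_⊆_ to _⊆ₗ_)
open import Data.List.Relation.Binary.Disjoint.Propositional using (Disjoint)
open import Data.List.Relation.Unary.Any using (Any; here; there)
import Data.List.Relation.Unary.Any.Properties as AnyP
open import Data.List.Relation.Unary.All as All using (All; []; _∷_)
open import Data.List.Relation.Unary.All.Properties using (anti-mono; ¬Any⇒All¬; All¬⇒¬Any)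
open import Data.List.Relation.Unary.AllPairs using ([]; _∷_)
open import Data.List.Relation.Unary.Unique.Propositional using (Unique)
open import Data.List.Relation.Unary.Unique.Propositional.Properties using (++⁺; Unique[x∷xs]⇒x∉xs)
import Data.List.Relation.Binary.Permutation.Setoid as Permutation
import Data.List.Relation.Binary.Permutation.Setoid.Properties as Perm
open import Function using (_∘_)
open import Function.Bundles using (_⇔_; mk⇔; Equivalence)
open import Relation.Binary.PropositionalEquality using (setoid; _≡_; _≢_; refl; sym; trans; cong; subst; ≢-sym)
open import Relation.Nullary using (¬_; yes; no; contradiction; _×-dec_; ¬?)
open import Relation.Nullary.Decidable using (⌊_⌋; toWitness; fromWitness; decidable-stable)

open Equivalence using (to; from)

T-not⁺ : ∀ {b} → ¬ T b → T (not b)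
T-not⁺ {false} _ = _
T-not⁺ {true} ¬t = ¬t _

T-not⁻ : ∀ {b} → T (not b) → ¬ T b
T-not⁻ {false} _ ()

T-anyFin : ∀ {n} (f : Fin n → Bool) → T (anyFin f) ⇔ ∃ (T ∘ f)
T-anyFin f = mk⇔ (elim f) (λ (i , fi) → intro f i fi)
  where
  intro : ∀ {n} (f : Fin n → Bool) i → T (f i) → T (anyFin f)
  intro f zero    fi = from T-∨ (inj₁ fi)
  intro f (suc i) fi = from T-∨ (inj₂ (intro (f ∘ suc) i fi))
  elim : ∀ {n} (f : Fin n → Bool) → T (anyFin f) → ∃ (T ∘ f)
  elim {suc n} f t with to T-∨ t
  ... | inj₁ f0 = zero , f0
  ... | inj₂ rest with elim (f ∘ suc) rest
  ...   | i , fi = suc i , fi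

T-inB : ∀ {n} {B : Subset n} {v} → T (inB B v) ⇔ v ∈ B
T-inB {B = B} {v} with lookup B v in eq
... | true  = mk⇔ (λ _ → lookup⇒[]= v B eq) _
... | false = mk⇔ (λ ()) (λ v∈B → contradiction (trans (sym ([]=⇒lookup v∈B)) eq) λ ())

∈-tabulate : ∀ {n} (f : Fin n → Bool) {v} → v ∈ tabulate f ⇔ T (f v)
∈-tabulate f {v} = mk⇔
  (λ v∈ → from T-≡ (trans (sym (lookup∘tabulate f v)) ([]=⇒lookup v∈)))
  (λ fv → lookup⇒[]= v (tabulate f) (trans (lookup∘tabulate f v) (to T-≡ fv)))

module _ {n} (G : Graph n) (B : Subset n) {v : Fin n} where

  δ⁺ : ∀ {u} → v ∉ B → u ∈ B → Adj G u v → v ∈ δ G B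
  δ⁺ {u} v∉B u∈B uv = from (∈-tabulate _)
    (from T-∧ (T-not⁺ (v∉B ∘ to T-inB) , from (T-anyFin _) (u , from T-∧ (from T-inB u∈B , uv))))

  δ⁻ : v ∈ δ G B → v ∉ B × ∃ λ u → u ∈ B × Adj G u v
  δ⁻ v∈δ with to T-∧ (to (∈-tabulate _) v∈δ)
  ... | v∉B , t with to (T-anyFin _) t
  ...   | u , tu with to T-∧ tu
  ...     | u∈B , uv = T-not⁻ v∉B ∘ from T-inB , u , to T-inB u∈B , uv

x∈p─q⇒x∉q : ∀ {n} (p q : Subset n) {x} → x ∈ p ─ q → x ∉ q
x∈p─q⇒x∉q (_ ∷ p) (true ∷ q) ()             Vec.here
x∈p─q⇒x∉q (_ ∷ p) (_    ∷ q) (Vec.there x∈) (Vec.there x∈q) = x∈p─q⇒x∉q p q x∈ x∈q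

x∈p-y⇒x∈p : ∀ {n} {p : Subset n} {x y} → x ∈ p - y → x ∈ p
x∈p-y⇒x∈p {p = p} {y = y} = p─q⊆p p ⁅ y ⁆

x∈p-y⇒x≢y : ∀ {n} {p : Subset n} {x y} → x ∈ p - y → x ≢ y
x∈p-y⇒x≢y {p = p} {y = y} = x∉⁅y⁆⇒x≢y ∘ x∈p─q⇒x∉q p ⁅ y ⁆

∣p∪q∣≤∣p∣+∣q∣ : ∀ {n} (p q : Subset n) → ∣ p ∪ q ∣ ≤ ∣ p ∣ + ∣ q ∣
∣p∪q∣≤∣p∣+∣q∣ []           []           = z≤n
∣p∪q∣≤∣p∣+∣q∣ (true  ∷ p) (true  ∷ q) rewrite +-suc ∣ p ∣ ∣ q ∣ = s≤s (m≤n⇒m≤1+n (∣p∪q∣≤∣p∣+∣q∣ p q))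
∣p∪q∣≤∣p∣+∣q∣ (true  ∷ p) (false ∷ q) = s≤s (∣p∪q∣≤∣p∣+∣q∣ p q)
∣p∪q∣≤∣p∣+∣q∣ (false ∷ p) (true  ∷ q) rewrite +-suc ∣ p ∣ ∣ q ∣ = s≤s (∣p∪q∣≤∣p∣+∣q∣ p q)
∣p∪q∣≤∣p∣+∣q∣ (false ∷ p) (false ∷ q) = ∣p∪q∣≤∣p∣+∣q∣ p q

∣q∣<∣p∣⇒∃∈p∖q : ∀ {n} {p q : Subset n} → ∣ q ∣ < ∣ p ∣ → ∃ λ x → x ∈ p × x ∉ q
∣q∣<∣p∣⇒∃∈p∖q {p = p} {q} ∣q∣<∣p∣ with any? (λ x → x ∈? p ×-dec ¬? (x ∈? q))
... | yes p∖q≢∅ = p∖q≢∅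
... | no  p∖q≡∅ = contradiction (p⊆q⇒∣p∣≤∣q∣ p⊆q) (<⇒≱ ∣q∣<∣p∣)
  where
  p⊆q : p ⊆ q
  p⊆q {x} x∈p = decidable-stable (x ∈? q) (λ x∉q → p∖q≡∅ (x , x∈p , x∉q))

module _ {n : ℕ} where

  toSubset : List (Fin n) → Subset n
  toSubset []       = ⊥
  toSubset (x ∷ xs) = ⁅ x ⁆ ∪ toSubset xs

  ∈toSubset⇒∈ : ∀ xs {x} → x ∈ toSubset xs → x ∈ₗ xs
  ∈toSubset⇒∈ []       x∈ = contradiction x∈ ∉⊥
  ∈toSubset⇒∈ (y ∷ xs) x∈ with x∈p∪q⁻ ⁅ y ⁆ (toSubset xs) x∈
  ... | inj₁ x∈⁅y⁆ = here (x∈⁅y⁆⇒x≡y y x∈⁅y⁆)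
  ... | inj₂ x∈xs  = there (∈toSubset⇒∈ xs x∈xs)

  length≤∣toSubset∣ : ∀ {xs} → Unique xs → length xs ≤ ∣ toSubset xs ∣
  length≤∣toSubset∣ {[]}     _         = z≤n
  length≤∣toSubset∣ {x ∷ xs} (x∉ ∷ xs!) = <-≤-trans (s≤s (length≤∣toSubset∣ xs!)) (p⊂q⇒∣p∣<∣q∣ xs⊂x∷xs)
    where
    xs⊂x∷xs : toSubset xs ⊂ toSubset (x ∷ xs)
    xs⊂x∷xs = x∈p∪q⁺ ∘ inj₂ , x , x∈p∪q⁺ (inj₁ (x∈⁅x⁆ x)) , All¬⇒¬Any x∉ ∘ ∈toSubset⇒∈ xs

  Unique⇒length≤n : ∀ {xs} → Unique xs → length xs ≤ n
  Unique⇒length≤n {xs} xs! = ≤-trans (length≤∣toSubset∣ xs!) (∣p∣≤n (toSubset xs))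

Unique-reverse : ∀ {a} {A : Set a} {xs : List A} → Unique xs → Unique (reverse xs)
Unique-reverse {A = A} {xs} = Unique-resp-↭ (↭-sym (↭-reverse xs))
  where
  open Perm (setoid A) using (Unique-resp-↭; ↭-reverse)
  open Permutation (setoid A) using (↭-sym)

∈-++-drop1⁻ : ∀ {a} {A : Set a} (xs : List A) {ys z} → z ∈ₗ xs ++ drop 1 ys → z ∈ₗ xs ⊎ z ∈ₗ ys
∈-++-drop1⁻ xs {ys} z∈ with AnyP.++⁻ xs z∈
... | inj₁ z∈xs = inj₁ z∈xs
... | inj₂ z∈ys = inj₂ (drop1⊆ ys z∈ys)
  where
  drop1⊆ : ∀ ys → drop 1 ys ⊆ₗ ys
  drop1⊆ (_ ∷ _) = there

adj-sym : ∀ {n} (G : Graph n) {u v} → Adj G u v → Adj G v u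
adj-sym G {u} {v} = subst T (symm G u v)

module _ {n} {G : Graph n} where

  open import Data.List.Membership.DecPropositional (_≟_ {n}) using () renaming (_∈?_ to _∈ₗ?_)

  first∈ : ∀ {a b xs} → Walk G a b xs → a ∈ₗ xs
  first∈ (single _) = here refl
  first∈ (step _ _) = here refl

  last∈ : ∀ {a b xs} → Walk G a b xs → b ∈ₗ xs
  last∈ (single _) = here refl
  last∈ (step _ w) = there (last∈ w)

  infixr 5 _++ʷ_
  infixl 6 _▷_

  _++ʷ_ : ∀ {a b c xs ys} → Walk G a b xs → Walk G b c ys → Walk G a c (xs ++ drop 1 ys)
  single _ ++ʷ single _ = single _
  single _ ++ʷ step e w = step e w
  step e w ++ʷ w′       = step e (w ++ʷ w′)

  _▷_ : ∀ {a b c xs} → Walk G a b xs → Adj G b c → Walk G a c (xs ++ [ c ])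
  w ▷ e = w ++ʷ step e (single _)

  reverseʷ : ∀ {a b xs} → Walk G a b xs → Walk G b a (reverse xs)
  reverseʷ (single _) = single _
  reverseʷ (step {u} {vs = vs} e w) =
    subst (Walk G _ _) (sym (unfold-reverse u vs)) (reverseʷ w ▷ adj-sym G e)

  suffix-path : ∀ {a b c xs} → Path G a b xs → c ∈ₗ xs → ∃ λ ys → Path G c b ys × ys ⊆ₗ xs
  suffix-path p@(single _ , _) (here refl) = _ , p , λ z∈ → z∈
  suffix-path p@(step _ _ , _) (here refl) = _ , p , λ z∈ → z∈
  suffix-path (step _ w , _ ∷ w!) (there c∈) with suffix-path (w , w!) c∈
  ... | ys , q , ys⊆ = ys , q , there ∘ ys⊆

  toPath : ∀ {a b xs} → Walk G a b xs → ∃ λ ys → Path G a b ys × ys ⊆ₗ xs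
  toPath (single a) = _ , (single a , [] ∷ []) , λ z∈ → z∈
  toPath (step {u} e w) with toPath w
  ... | ys , (q , ys!) , ys⊆ with u ∈ₗ? ys
  ...   | no u∉ys =
    u ∷ ys , (step e q , ¬Any⇒All¬ ys u∉ys ∷ ys!) , λ { (here z≡u) → here z≡u ; (there z∈) → there (ys⊆ z∈) }
  ...   | yes u∈ys with suffix-path (q , ys!) u∈ys
  ...     | zs , q′ , zs⊆ = zs , q′ , there ∘ ys⊆ ∘ zs⊆

  join-at : ∀ {r u w xs ys} → Path G r u (r ∷ xs) → Path G r w (r ∷ ys) → Disjoint xs ys →
            Path G u w (reverse (r ∷ xs) ++ ys)
  join-at {r} {xs = xs} {ys} (p , p!) (q , q!@(_ ∷ ys!)) xs∩ys≡∅ =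
    reverseʷ p ++ʷ q , ++⁺ (Unique-reverse p!) ys! disjoint
    where
    disjoint : Disjoint (reverse (r ∷ xs)) ys
    disjoint (z∈ , z∈ys) with AnyP.reverse⁻ {xs = r ∷ xs} z∈
    ... | here refl  = Unique[x∷xs]⇒x∉xs q! z∈ys
    ... | there z∈xs = xs∩ys≡∅ (z∈xs , z∈ys)

  walk-between-neighbours-visits : Acyclic G → ∀ {r p q vs} → Adj G r p → Adj G r q → p ≢ q →
                                   Walk G p q vs → r ∈ₗ vs
  walk-between-neighbours-visits acyclic {r} {p} {q} {vs} rp rq p≢q w
    with r ∈ₗ? vs | toPath w
  ... | yes r∈vs | _ = r∈vs
  ... | no r∉vs  | ys , (w′ , ys!) , ys⊆vs =
    ⊥-elim (acyclic (r , q , r ∷ ys , (step rp w′ , ¬Any⇒All¬ ys (r∉vs ∘ ys⊆vs) ∷ ys!) ,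
                     s≤s (2≤length w′) , adj-sym G rq))
    where
    2≤length : ∀ {zs} → Walk G p q zs → 2 ≤ length zs
    2≤length (single _)           = contradiction refl p≢q
    2≤length (step _ (single _))  = s≤s (s≤s z≤n)
    2≤length (step _ (step _ _))  = s≤s (s≤s z≤n)

  split-at : ∀ {u w r vs} → Path G u w vs → r ∈ₗ vs → r ≢ u → r ≢ w →
             ∃₂ λ p q → ∃₂ λ xs ys →
               Walk G u p xs × r ∉ₗ xs × Adj G p r × Adj G r q × Walk G q w ys × r ∉ₗ ys × p ≢ q
  split-at (single _ , _) (here refl) r≢u _ = contradiction refl r≢u
  split-at (step _ _ , _) (here refl) r≢u _ = contradiction refl r≢u
  split-at (step _ (single _) , _) (there (here refl)) _ r≢w = contradiction refl r≢w
  split-at (step pr (step rq w) , u∉ ∷ (r∉ ∷ _)) (there (here refl)) r≢u _ =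
    _ , _ , _ , _ , single _ , (λ { (here r≡u) → r≢u r≡u ; (there ()) }) , pr , rq , w , All¬⇒¬Any r∉ ,
    All.lookup u∉ (there (first∈ w))
  split-at (step e (step e′ w) , _ ∷ w!@(v∉ ∷ _)) (there (there r∈)) r≢u r≢w
    with split-at (step e′ w , w!) (there r∈) (≢-sym (All.lookup v∉ r∈)) r≢w
  ... | p , q , xs , ys , wx , r∉xs , pr , rq , wy , r∉ys , p≢q =
    p , q , _ ∷ xs , ys , step e wx , (λ { (here r≡u) → r≢u r≡u ; (there r∈xs) → r∉xs r∈xs }) ,
    pr , rq , wy , r∉ys , p≢q

  path-vertices-on-walks : Acyclic G → ∀ {u w r vs ws} → Path G u w vs → r ∈ₗ vs → Walk G u w ws → r ∈ₗ ws
  path-vertices-on-walks acyclic {r = r} {ws = ws} path r∈vs walk with r ∈ₗ? ws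
  ... | yes r∈ws = r∈ws
  ... | no r∉ws
    with split-at path r∈vs (λ { refl → r∉ws (first∈ walk) }) (λ { refl → r∉ws (last∈ walk) })
  ...   | p , q , xs , ys , wx , r∉xs , pr , rq , wy , r∉ys , p≢q =
    contradiction (walk-between-neighbours-visits acyclic (adj-sym G pr) rq p≢q
                    (reverseʷ wx ++ʷ walk ++ʷ reverseʷ wy)) avoided
    where
    avoided : r ∉ₗ reverse xs ++ drop 1 (ws ++ drop 1 (reverse ys))
    avoided r∈ with ∈-++-drop1⁻ (reverse xs) r∈
    ... | inj₁ r∈xs = r∉xs (AnyP.reverse⁻ r∈xs)
    ... | inj₂ r∈ with ∈-++-drop1⁻ ws r∈
    ...   | inj₁ r∈ws = r∉ws r∈ws
    ...   | inj₂ r∈ys = r∉ys (AnyP.reverse⁻ r∈ys)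

Closed : ∀ {n} → Graph n → Subset n → Subset n → Set
Closed G B C = ∀ u w → u ∈ C → w ∈ B → Adj G u w → w ∈ C

module _ {n} {G : Graph n} {B C : Subset n} (closed : Closed G B C) where

  walk-meeting-closed⊆ : ∀ {u v vs} → Walk G u v vs → All (_∈ B) vs → Any (_∈ C) vs → All (_∈ C) vs
  walk-meeting-closed⊆ (single _) _ (here u∈C) = u∈C ∷ []
  walk-meeting-closed⊆ (step e w) (_ ∷ w⊆B) (here u∈C) =
    u∈C ∷ walk-meeting-closed⊆ w w⊆B (lose (first∈ w) (closed _ _ u∈C (All.lookup w⊆B (first∈ w)) e))
  walk-meeting-closed⊆ (step e w) (u∈B ∷ w⊆B) (there meets) with walk-meeting-closed⊆ w w⊆B meets
  ... | w⊆C = closed _ _ (All.lookup w⊆C (first∈ w)) u∈B (adj-sym G e) ∷ w⊆C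

-- The component of x in G[B] as bounded reachability towards x: n rounds
-- suffice because a walk inside B shortens to a path, of at most n vertices.
module Component {n} (G : Graph n) (B : Subset n) {x} (x∈B : x ∈ B) where

  private
    reach : ℕ → Fin n → Bool
    reach zero    v = false
    reach (suc m) v = ⌊ v ≟ x ⌋ ∨ (inB B v ∧ anyFin (λ w → adj G v w ∧ reach m w))

    reach-sound : ∀ m {v} → T (reach m v) → ∃ λ vs → Walk G v x vs × All (_∈ B) vs
    reach-sound (suc m) {v} t with to T-∨ t
    ... | inj₁ v≡x with toWitness {a? = v ≟ x} v≡x
    ...   | refl = _ , single x , x∈B ∷ []
    reach-sound (suc m) {v} t | inj₂ t′ with to T-∧ t′
    ... | v∈B , t″ with to (T-anyFin (λ w → adj G v w ∧ reach m w)) t″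
    ...   | w , tw with to T-∧ tw
    ...     | vw , reach-w with reach-sound m reach-w
    ...       | vs , walk , vs⊆B = v ∷ vs , step vw walk , to T-inB v∈B ∷ vs⊆B

    reach-complete : ∀ m {v vs} → Walk G v x vs → All (_∈ B) vs → length vs ≤ m → T (reach m v)
    reach-complete (suc m) (single _) _ _ = from T-∨ (inj₁ (fromWitness {a? = x ≟ x} refl))
    reach-complete (suc m) (step vw walk) (v∈B ∷ vs⊆B) (s≤s len) =
      from T-∨ (inj₂ (from T-∧ (from T-inB v∈B ,
        from (T-anyFin (λ w → adj G _ w ∧ reach m w)) (_ , from T-∧ (vw , reach-complete m walk vs⊆B len)))))

  component : Subset n
  component = tabulate (reach n)

  walk⇒∈component : ∀ {v vs} → Walk G v x vs → All (_∈ B) vs → v ∈ component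
  walk⇒∈component walk vs⊆B with toPath walk
  ... | ys , (path , ys!) , ys⊆vs =
    from (∈-tabulate _) (reach-complete n path (anti-mono ys⊆vs vs⊆B) (Unique⇒length≤n ys!))

  ∈component⇒walk : ∀ {v} → v ∈ component → ∃ λ vs → Walk G v x vs × All (_∈ B) vs
  ∈component⇒walk v∈C = reach-sound n (to (∈-tabulate _) v∈C)

  closed : Closed G B component
  closed u w u∈C w∈B uw with ∈component⇒walk u∈C
  ... | _ , walk , vs⊆B = walk⇒∈component (step (adj-sym G uw) walk) (w∈B ∷ vs⊆B)

  x∈component : x ∈ component
  x∈component = walk⇒∈component (single x) (x∈B ∷ [])

  component⊆ : component ⊆ B
  component⊆ v∈C with ∈component⇒walk v∈C
  ... | _ , walk , vs⊆B = All.lookup vs⊆B (first∈ walk)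

  isComponent : IsComponent G B component
  isComponent = (x , x∈component) , component⊆ , connected , closed
    where
    walk⊆component : ∀ {v vs} → Walk G v x vs → All (_∈ B) vs → All (_∈ component) vs
    walk⊆component walk vs⊆B = walk-meeting-closed⊆ closed walk vs⊆B (lose (last∈ walk) x∈component)
    connected : Connected G component
    connected u v u∈C v∈C with ∈component⇒walk u∈C | ∈component⇒walk v∈C
    ... | us , wu , us⊆B | vs , wv , vs⊆B = us ++ drop 1 (reverse vs) , wu ++ʷ reverseʷ wv , All.tabulate on-C
      where
      on-C : ∀ {z} → z ∈ₗ us ++ drop 1 (reverse vs) → z ∈ component
      on-C z∈ with ∈-++-drop1⁻ us z∈
      ... | inj₁ z∈us = All.lookup (walk⊆component wu us⊆B) z∈us
      ... | inj₂ z∈vs = All.lookup (walk⊆component wv vs⊆B) (AnyP.reverse⁻ z∈vs)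

module _ {n} {G : Graph n} {A : Subset n} {r : Fin n} {C : Subset n}
         (C-component : IsComponent G (A - r) C) where

  private
    C⊆A-r : C ⊆ A - r
    C⊆A-r = proj₁ (proj₂ C-component)

    C-closed : Closed G (A - r) C
    C-closed = proj₂ (proj₂ (proj₂ C-component))

  δ-component⊆ : δ G C ⊆ δ G A ∪ ⁅ r ⁆
  δ-component⊆ {z} z∈δC with δ⁻ G C z∈δC
  ... | z∉C , c , c∈C , cz with z ∈? A
  ...   | no z∉A = x∈p∪q⁺ (inj₁ (δ⁺ G A z∉A (x∈p-y⇒x∈p (C⊆A-r c∈C)) cz))
  ...   | yes z∈A with z ≟ r
  ...     | yes refl = x∈p∪q⁺ (inj₂ (x∈⁅x⁆ r))
  ...     | no z≢r   = contradiction (C-closed c z c∈C (x∈p∧x≢y⇒x∈p-y z∈A z≢r) cz) z∉C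

  ∣δ-component∣≤ : ∣ δ G C ∣ ≤ suc ∣ δ G A ∣
  ∣δ-component∣≤ = begin
    ∣ δ G C ∣             ≤⟨ p⊆q⇒∣p∣≤∣q∣ δ-component⊆ ⟩
    ∣ δ G A ∪ ⁅ r ⁆ ∣     ≤⟨ ∣p∪q∣≤∣p∣+∣q∣ (δ G A) ⁅ r ⁆ ⟩
    ∣ δ G A ∣ + ∣ ⁅ r ⁆ ∣ ≡⟨ cong (∣ δ G A ∣ +_) (∣⁅x⁆∣≡1 r) ⟩
    ∣ δ G A ∣ + 1         ≡⟨ +-comm _ 1 ⟩
    suc ∣ δ G A ∣         ∎
    where open ≤-Reasoning

  ∣δ-component∣≤-missing : ∀ {u} → u ∈ δ G A → u ∉ δ G C → ∣ δ G C ∣ ≤ ∣ δ G A ∣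
  ∣δ-component∣≤-missing {u} u∈δA u∉δC = begin
    ∣ δ G C ∣                 ≤⟨ p⊆q⇒∣p∣≤∣q∣ δC⊆ ⟩
    ∣ (δ G A - u) ∪ ⁅ r ⁆ ∣   ≤⟨ ∣p∪q∣≤∣p∣+∣q∣ (δ G A - u) ⁅ r ⁆ ⟩
    ∣ δ G A - u ∣ + ∣ ⁅ r ⁆ ∣ ≡⟨ cong (∣ δ G A - u ∣ +_) (∣⁅x⁆∣≡1 r) ⟩
    ∣ δ G A - u ∣ + 1         ≡⟨ +-comm _ 1 ⟩
    suc ∣ δ G A - u ∣         ≤⟨ x∈p⇒∣p-x∣<∣p∣ u∈δA ⟩
    ∣ δ G A ∣                 ∎
    where
    open ≤-Reasoning
    δC⊆ : δ G C ⊆ (δ G A - u) ∪ ⁅ r ⁆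
    δC⊆ z∈δC with x∈p∪q⁻ (δ G A) ⁅ r ⁆ (δ-component⊆ z∈δC)
    ... | inj₁ z∈δA  = x∈p∪q⁺ (inj₁ (x∈p∧x≢y⇒x∈p-y z∈δA λ { refl → u∉δC z∈δC }))
    ... | inj₂ z∈⁅r⁆ = x∈p∪q⁺ (inj₂ z∈⁅r⁆)

path-ends-separated : ∀ {n} {G : Graph n} → Acyclic G → ∀ {u w r vs} {C : Subset n} →
                      Path G u w vs → r ∈ₗ vs → r ≢ u → r ≢ w → Connected G C → r ∉ C →
                      u ∈ δ G C → w ∉ δ G C
path-ends-separated {G = G} acyclic {u} {w} {r} {C = C} path r∈vs r≢u r≢w C-connected r∉C u∈δC w∈δC
  with δ⁻ G C u∈δC | δ⁻ G C w∈δC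
... | _ , cu , cu∈C , cu-u | _ , cw , cw∈C , cw-w with C-connected cu cw cu∈C cw∈C
... | zs , cu⇝cw , zs⊆C =
  avoided (path-vertices-on-walks acyclic path r∈vs (step (adj-sym G cu-u) (cu⇝cw ▷ cw-w)))
  where
  avoided : r ∉ₗ u ∷ zs ++ [ w ]
  avoided (here r≡u) = r≢u r≡u
  avoided (there r∈) with AnyP.++⁻ zs r∈
  ... | inj₁ r∈zs        = r∉C (All.lookup zs⊆C r∈zs)
  ... | inj₂ (here r≡w) = r≢w r≡w

module _ {n} (G : Graph n) (A : Subset n) where

  record Exit (r d : Fin n) : Set where
    constructor exit
    field
      {last}  : Fin n
      {tail}  : List (Fin n)
      path    : Path G r last (r ∷ tail)
      inside  : All (_∈ A - r) tail
      leaves  : Adj G last d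

  open Exit

  path⇒exit : ∀ {r a d vs} → Path G r a vs → All (_∈ A) vs → Adj G a d → Exit r d
  path⇒exit p@(single _ , _)            _          ad = exit p [] ad
  path⇒exit p@(step _ _ , r∉tail ∷ _) (_ ∷ tail⊆A) ad =
    exit p (All.zipWith (λ (r≢z , z∈A) → x∈p∧x≢y⇒x∈p-y z∈A (≢-sym r≢z)) (r∉tail , tail⊆A)) ad

  exit-to : Connected G A → ∀ {r d} → r ∈ A → d ∈ δ G A → Exit r d
  exit-to A-connected {r} r∈A d∈δA with δ⁻ G A d∈δA
  ... | _ , a , a∈A , ad with A-connected r a r∈A a∈A
  ...   | _ , walk , vs⊆A with toPath walk
  ...     | _ , path , ys⊆vs = path⇒exit path (anti-mono ys⊆vs vs⊆A) ad

  exit-path : ∀ {r d} → r ∈ A → d ∉ A → (e : Exit r d) → Path G r d (r ∷ tail e ++ [ d ])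
  exit-path r∈A d∉A (exit (walk , walk!) inside leaves) = walk ▷ leaves , ++⁺ walk! ([] ∷ []) d∉route
    where
    d∉route : Disjoint (_ ∷ _) [ _ ]
    d∉route (here refl , here refl) = d∉A r∈A
    d∉route (there d∈ , here refl)  = d∉A (x∈p-y⇒x∈p (All.lookup inside d∈))

  exit-meeting-closed⇒last∈ : ∀ {r d C} → Closed G (A - r) C →
                              (e : Exit r d) → Any (_∈ C) (tail e) → last e ∈ C
  exit-meeting-closed⇒last∈ closed (exit (step _ w , _) inside _) meets =
    All.lookup (walk-meeting-closed⊆ closed w inside meets) (last∈ w)

  exits⇒hull : ∀ {r d₁ d₂} → r ∈ A → d₁ ∈ δ G A → d₂ ∈ δ G A → (e₁ : Exit r d₁) (e₂ : Exit r d₂) →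
               Disjoint (tail e₁ ++ [ d₁ ]) (tail e₂ ++ [ d₂ ]) → InHull G (δ G A) r
  exits⇒hull {r} {d₁} r∈A d₁∈δA d₂∈δA e₁ e₂ disjoint =
    _ , _ , _ , d₁∈δA , d₂∈δA ,
    join-at (exit-path r∈A (proj₁ (δ⁻ G A d₁∈δA)) e₁) (exit-path r∈A (proj₁ (δ⁻ G A d₂∈δA)) e₂)
            disjoint ,
    AnyP.++⁺ˡ (AnyP.reverse⁺ {xs = r ∷ tail e₁ ++ [ d₁ ]} (here refl))

every-vertex-is-root : ∀ {n} {G : Graph n} {k A} → ∣ δ G A ∣ < k →
                       ∀ {r} → r ∈ A → IsAdmissibleRoot G k A r
every-vertex-is-root ∣δA∣<k r∈A =
  r∈A , λ { C C-component@(_ , _ , C-connected , _) →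
    C-connected , ≤-trans (∣δ-component∣≤ C-component) ∣δA∣<k }

hull⇒root : ∀ {n} {G : Graph n} {k A} → Acyclic G → ∣ δ G A ∣ ≡ k →
            ∀ {r} → InHull G (δ G A) r → r ∈ A → IsAdmissibleRoot G k A r
hull⇒root {G = G} {A = A} acyclic ∣δA∣≡k {r} (u , w , _ , u∈δA , w∈δA , path , r∈path) r∈A =
  r∈A , λ { C C-component@(_ , _ , C-connected , _) →
    C-connected , ≤-trans (∣δC∣≤∣δA∣ C-component) (≤-reflexive ∣δA∣≡k) }
  where
  ∉A⇒≢r : ∀ {d} → d ∉ A → r ≢ d
  ∉A⇒≢r d∉A refl = d∉A r∈A

  ∣δC∣≤∣δA∣ : ∀ {C} → IsComponent G (A - r) C → ∣ δ G C ∣ ≤ ∣ δ G A ∣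
  ∣δC∣≤∣δA∣ {C} C-component@(_ , C⊆A-r , C-connected , _) with u ∈? δ G C
  ... | no u∉δC  = ∣δ-component∣≤-missing C-component u∈δA u∉δC
  ... | yes u∈δC = ∣δ-component∣≤-missing C-component w∈δA
    (path-ends-separated acyclic path r∈path
      (∉A⇒≢r (proj₁ (δ⁻ G A u∈δA))) (∉A⇒≢r (proj₁ (δ⁻ G A w∈δA)))
      C-connected (λ r∈C → x∈p-y⇒x≢y (C⊆A-r r∈C) refl) u∈δC)

module _ {n} {G : Graph n} {k} {A : Subset n} (A-connected : Connected G A) (∣δA∣≡k : ∣ δ G A ∣ ≡ k)
         {r} (root : IsAdmissibleRoot G k A r) where

  open Exit

  private
    r∈A : r ∈ A
    r∈A = proj₁ root

    δ-outside : ∀ {d} → d ∈ δ G A → d ∉ A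
    δ-outside = proj₁ ∘ δ⁻ G A

    small<∣δA∣ : 2 ≤ k → ∀ (p : Subset n) → ∣ p ∣ ≤ 1 → ∣ p ∣ < ∣ δ G A ∣
    small<∣δA∣ 2≤k p ∣p∣≤1 = begin-strict
      ∣ p ∣     ≤⟨ ∣p∣≤1 ⟩
      1         <⟨ 2≤k ⟩
      k         ≡⟨ sym ∣δA∣≡k ⟩
      ∣ δ G A ∣ ∎
      where open ≤-Reasoning

  indirect-exit⇒hull : ∀ {d₁ x} → d₁ ∈ δ G A → (e₁ : Exit G A r d₁) →
                       Adj G r x → Walk G x (last e₁) (tail e₁) → InHull G (δ G A) r
  indirect-exit⇒hull {d₁} {x} d₁∈δA e₁ rx x⇝ = other-exit⇒hull (∣q∣<∣p∣⇒∃∈p∖q ∣δC-r∣<∣δA∣)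
    where
    x∈A-r : x ∈ A - r
    x∈A-r = All.lookup (inside e₁) (first∈ x⇝)

    open Component G (A - r) x∈A-r

    tail⊆C : All (_∈ component) (tail e₁)
    tail⊆C = walk-meeting-closed⊆ closed x⇝ (inside e₁) (lose (first∈ x⇝) x∈component)

    outside-C : ∀ {d} → d ∉ A → d ∉ component
    outside-C d∉A = d∉A ∘ x∈p-y⇒x∈p ∘ component⊆

    r∈δC : r ∈ δ G component
    r∈δC = δ⁺ G component (λ r∈C → x∈p-y⇒x≢y (component⊆ r∈C) refl) x∈component (adj-sym G rx)

    d₁∈δC : d₁ ∈ δ G component
    d₁∈δC = δ⁺ G component (outside-C (δ-outside d₁∈δA)) (All.lookup tail⊆C (last∈ x⇝)) (leaves e₁)

    ∣δC-r∣<∣δA∣ : ∣ δ G component - r ∣ < ∣ δ G A ∣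
    ∣δC-r∣<∣δA∣ = begin-strict
      ∣ δ G component - r ∣ <⟨ x∈p⇒∣p-x∣<∣p∣ r∈δC ⟩
      ∣ δ G component ∣     ≤⟨ proj₂ (proj₂ root component isComponent) ⟩
      k                     ≡⟨ sym ∣δA∣≡k ⟩
      ∣ δ G A ∣             ∎
      where open ≤-Reasoning

    other-exit⇒hull : (∃ λ d₂ → d₂ ∈ δ G A × d₂ ∉ δ G component - r) → InHull G (δ G A) r
    other-exit⇒hull (d₂ , d₂∈δA , d₂∉δC-r) = exits⇒hull G A r∈A d₁∈δA d₂∈δA e₁ e₂ disjoint
      where
      e₂ : Exit G A r d₂
      e₂ = exit-to G A A-connected r∈A d₂∈δA

      d₂∉δC : d₂ ∉ δ G component
      d₂∉δC d₂∈δC = d₂∉δC-r (x∈p∧x≢y⇒x∈p-y d₂∈δC λ { refl → δ-outside d₂∈δA r∈A })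

      disjoint : Disjoint (tail e₁ ++ [ d₁ ]) (tail e₂ ++ [ d₂ ])
      disjoint (z∈₁ , z∈₂) with AnyP.++⁻ (tail e₁) z∈₁ | AnyP.++⁻ (tail e₂) z∈₂
      ... | inj₁ z∈T₁        | inj₁ z∈T₂ =
        d₂∉δC (δ⁺ G component (outside-C (δ-outside d₂∈δA))
                 (exit-meeting-closed⇒last∈ G A closed e₂ (lose z∈T₂ (All.lookup tail⊆C z∈T₁))) (leaves e₂))
      ... | inj₂ (here refl) | inj₁ z∈T₂        = δ-outside d₁∈δA (x∈p-y⇒x∈p (All.lookup (inside e₂) z∈T₂))
      ... | inj₁ z∈T₁        | inj₂ (here refl) = outside-C (δ-outside d₂∈δA) (All.lookup tail⊆C z∈T₁)
      ... | inj₂ (here refl) | inj₂ (here refl) = d₂∉δC d₁∈δC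

  root⇒hull : 2 ≤ k → InHull G (δ G A) r
  root⇒hull 2≤k with ∣q∣<∣p∣⇒∃∈p∖q {q = ⊥} (small<∣δA∣ 2≤k ⊥ (≤-trans (≤-reflexive (∣⊥∣≡0 n)) z≤n))
  ... | d₁ , d₁∈δA , _ with exit-to G A A-connected r∈A d₁∈δA
  ...   | e₁@(exit (step rx x⇝ , _) _ _) = indirect-exit⇒hull d₁∈δA e₁ rx x⇝
  ...   | e₁@(exit (single _ , _) _ _)
    with ∣q∣<∣p∣⇒∃∈p∖q (small<∣δA∣ 2≤k ⁅ d₁ ⁆ (≤-reflexive (∣⁅x⁆∣≡1 d₁)))
  ...     | d₂ , d₂∈δA , d₂∉⁅d₁⁆ with exit-to G A A-connected r∈A d₂∈δA
  ...       | e₂@(exit (step rx x⇝ , _) _ _) = indirect-exit⇒hull d₂∈δA e₂ rx x⇝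
  ...       | e₂@(exit (single _ , _) _ _) =
    exits⇒hull G A r∈A d₁∈δA d₂∈δA e₁ e₂ λ { (here refl , here refl) → d₂∉⁅d₁⁆ (x∈⁅x⁆ d₁) }

lemma7 : ∀ {n} (S : Graph n) → IsTree S → (k : ℕ) → 2 ≤ k →
    (A : Subset n) → Admissible S k A →
    (∣ δ S A ∣ < k → ∀ r → r ∈ A → IsAdmissibleRoot S k A r) ×
    (∣ δ S A ∣ ≡ k → ∀ r → (IsAdmissibleRoot S k A r ⇔ (InHull S (δ S A) r × r ∈ A)))
lemma7 S (_ , acyclic) k 2≤k A (A-connected , _) =
  (λ ∣δA∣<k _ r∈A → every-vertex-is-root ∣δA∣<k r∈A) ,
  λ ∣δA∣≡k _ → mk⇔
    (λ root → root⇒hull A-connected ∣δA∣≡k root 2≤k , proj₁ root)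
    (λ (r∈hull , r∈A) → hull⇒root acyclic ∣δA∣≡k r∈hull r∈A)
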